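{- Let $p$ be a prime. A $p$-clock sum of length $p$ has period $1$ (as an element of $\Omega_2$). A $p$-clock sum of length $l$ with $1\le l<p$ has period $p$.
   Context: $\mathbb{N}=\{0,1,2,\dots\}$. For a prime $p$ and integer $0\le t\le p-1$, the prime clock $[p,t]:\mathbb{N}\to\mathbb{N}$ is $[p,t](m)=(m+t)\bmod p$. $\Omega_2$ is the set of functions $\mathbb{N}\to\mathbb{Z}_2=\{0,1\}$. For prime clocks $[q_1,t_1],\dots,[q_l,t_l]$, the sum $[q_1,t_1]\oplus\cdots\oplus[q_l,t_l]\in\Omega_2$ is the function $m\mapsto\big(\sum_{i=1}^l [q_i,t_i](m)\big)\bmod 2$. A $p$-clock sum of length $l$ is a sum $[p,t_1]\oplus\cdots\oplus[p,t_l]$ in $\Omega_2$ where $t_1,\dots,t_l\in\{0,\dots,p-1\}$ are pairwise distinct (so $l\le p$). A function $f\in\Omega_2$ has period $a$ if $a$ is the smallest positive integer with $f(m)=f(m+a)$ for all $m\in\mathbb{N}$. -}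

module Defs where

open import Data.Nat using (ℕ; zero; suc; _+_; _<_; NonZero)
open import Data.Nat.DivMod using (_%_)
open import Data.List using (List; map)
open import Data.Nat.ListAction using (sum)
open import Data.Product using (_×_)
open import Relation.Nullary using (¬_)
open import Relation.Binary.PropositionalEquality using (_≡_)

-- Ω₂ : functions ℕ → ℤ₂, with ℤ₂ represented as {0,1} ⊆ ℕ (values computed mod 2)
Ω₂ : Set
Ω₂ = ℕ → ℕ

clock : (p : ℕ) .{{_ : NonZero p}} → ℕ → ℕ → ℕ
clock p t m = (m + t) % p

clockSum : (p : ℕ) .{{_ : NonZero p}} → List ℕ → Ω₂
clockSum p ts m = sum (map (λ t → clock p t m) ts) % 2

IsShiftInvariant : Ω₂ → ℕ → Set
IsShiftInvariant f a = ∀ m → f m ≡ f (m + a)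

HasPeriod : Ω₂ → ℕ → Set
HasPeriod f a = (0 < a) × IsShiftInvariant f a × (∀ b → 0 < b → b < a → ¬ IsShiftInvariant f b)

-- Stepping m to m + 1 raises every clock by one, except that a clock at p − 1
-- wraps round to 0.  Hence the integer sum S(m) of the clocks satisfies
-- S(m + 1) + p·c(m) = S(m) + l, where c(m) counts the clocks at p − 1; as the
-- tᵢ are distinct residues, c(m) is 1 if (p − 1 − m) mod p is among them and 0
-- otherwise.  For l = p it is always 1, so S is constant.  For 1 ≤ l < p both
-- values occur, so 1-periodicity of S mod 2 would give p ≡ l ≡ 0 (mod 2),
-- forcing p = 2 and l = 1, which is absurd.  Finally, for p prime a p-periodic
-- function that is not 1-periodic has period p, since by Bézout a shorter
-- period would combine with p into the period 1.
module Submission where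

open import Defs
open import Data.Empty using (⊥-elim)
open import Data.List using (List; []; _∷_; _++_; length; map; upTo)
open import Data.List.Membership.Propositional using (_∈_; _∉_; find)
open import Data.List.Membership.Propositional.Properties
  using (∈-∃++; ∈-++⁺ˡ; ∈-++⁺ʳ; ∈-++⁻; ∈-upTo⁺; ∈-upTo⁻)
open import Data.List.Properties using (length-++-sucʳ; length-upTo; map-cong)
open import Data.List.Relation.Binary.Subset.Propositional using (_⊆_)
open import Data.List.Relation.Unary.All as All using (All; _∷_; all?)
open import Data.List.Relation.Unary.All.Properties using (¬All⇒Any¬; ¬Any⇒All¬; All¬⇒¬Any)
open import Data.List.Relation.Unary.AllPairs using (_∷_)
open import Data.List.Relation.Unary.Any using (here; there)
open import Data.List.Relation.Unary.Unique.Propositional using (Unique)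
open import Data.List.Relation.Unary.Unique.Propositional.Properties using (upTo⁺)
open import Data.Nat
open import Data.List.Membership.DecPropositional _≟_ using (_∈?_)
open import Data.Nat.Coprimality using (coprime-Bézout; prime⇒coprime)
open import Data.Nat.Divisibility using (m%n≡0⇒n∣m)
open import Data.Nat.DivMod
open import Data.Nat.GCD using (module Bézout)
open import Data.Nat.ListAction using (sum)
open import Data.Nat.Primality using (Prime; prime⇒irreducible; prime⇒nonZero)
open import Data.Nat.Properties
open import Algebra.Properties.CommutativeSemigroup +-commutativeSemigroup
  using (interchange; xy∙z≈xz∙y)
open import Data.Product using (∃; _×_; _,_)
open import Data.Sum using (inj₁; inj₂)
open import Function using (_∘_)
open import Relation.Binary.PropositionalEquality
open import Relation.Nullary using (¬_; yes; no)

open ≡-Reasoning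

unique-⊆⇒length≤ : {A : Set} {xs ys : List A} → Unique xs → xs ⊆ ys → length xs ≤ length ys
unique-⊆⇒length≤ {xs = []} _ _ = z≤n
unique-⊆⇒length≤ {xs = x ∷ xs} (x∉xs ∷ u) x∷xs⊆ys with ∈-∃++ (x∷xs⊆ys (here refl))
... | as , bs , refl = ≤-trans (s≤s (unique-⊆⇒length≤ u xs⊆as++bs)) (≤-reflexive (sym (length-++-sucʳ as x bs)))
  where
  xs⊆as++bs : xs ⊆ as ++ bs
  xs⊆as++bs y∈xs with ∈-++⁻ as (x∷xs⊆ys (there y∈xs))
  ... | inj₁ y∈as = ∈-++⁺ˡ y∈as
  ... | inj₂ (here refl) = ⊥-elim (All.lookup x∉xs y∈xs refl)
  ... | inj₂ (there y∈bs) = ∈-++⁺ʳ as y∈bs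

unique-bounded⇒length≤ : ∀ {n xs} → Unique xs → All (_< n) xs → length xs ≤ n
unique-bounded⇒length≤ {n} u xs<n =
  subst (_ ≤_) (length-upTo n) (unique-⊆⇒length≤ u (λ x∈xs → ∈-upTo⁺ (All.lookup xs<n x∈xs)))

length≡⇒∈ : ∀ {n v xs} → Unique xs → All (_< n) xs → length xs ≡ n → v < n → v ∈ xs
length≡⇒∈ {v = v} {xs} u xs<n len≡n v<n with v ∈? xs
... | yes v∈xs = v∈xs
... | no v∉xs = ⊥-elim (<-irrefl len≡n (unique-bounded⇒length≤ (¬Any⇒All¬ xs v∉xs ∷ u) (v<n ∷ xs<n)))

length<⇒∃∉ : ∀ {n xs} → length xs < n → ∃ λ v → v < n × v ∉ xs
length<⇒∃∉ {n} {xs} len<n with all? (_∈? xs) (upTo n)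
... | yes upTo⊆xs = ⊥-elim (<⇒≱ len<n (subst (_≤ length xs) (length-upTo n)
                      (unique-⊆⇒length≤ (upTo⁺ n) (All.lookup upTo⊆xs))))
... | no upTo⊈xs with find (¬All⇒Any¬ (_∈? xs) (upTo n) upTo⊈xs)
...   | v , v∈upTo , v∉xs = v , ∈-upTo⁻ v∈upTo , v∉xs

[m+n]%d≡[m%d+n]%d : ∀ m n d .{{_ : NonZero d}} → (m + n) % d ≡ (m % d + n) % d
[m+n]%d≡[m%d+n]%d m n d = begin
  (m + n) % d              ≡⟨ %-distribˡ-+ m n d ⟩
  (m % d + n % d) % d      ≡⟨ cong (λ r → (r + n % d) % d) (m%n%n≡m%n m d) ⟨
  (m % d % d + n % d) % d  ≡⟨ %-distribˡ-+ (m % d) n d ⟨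
  (m % d + n) % d          ∎

%-cancelˡ-+ : ∀ a x y d .{{_ : NonZero d}} → (a + x) % d ≡ (a + y) % d → x % d ≡ y % d
%-cancelˡ-+ a x y d@(suc d-1) eq = begin
  x % d                          ≡⟨ [m+kn]%n≡m%n x a d ⟨
  (x + a * d) % d                ≡⟨ cong (_% d) (absorb x) ⟩
  (a + x + a * d-1) % d          ≡⟨ [m+n]%d≡[m%d+n]%d (a + x) (a * d-1) d ⟩
  ((a + x) % d + a * d-1) % d    ≡⟨ cong (λ r → (r + a * d-1) % d) eq ⟩
  ((a + y) % d + a * d-1) % d    ≡⟨ [m+n]%d≡[m%d+n]%d (a + y) (a * d-1) d ⟨
  (a + y + a * d-1) % d          ≡⟨ cong (_% d) (absorb y) ⟨
  (y + a * d) % d                ≡⟨ [m+kn]%n≡m%n y a d ⟩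
  y % d                          ∎
  where
  absorb : ∀ z → z + a * d ≡ a + z + a * d-1
  absorb z = begin
    z + a * suc d-1    ≡⟨ cong (z +_) (*-suc a d-1) ⟩
    z + (a + a * d-1)  ≡⟨ +-assoc z a (a * d-1) ⟨
    z + a + a * d-1    ≡⟨ cong (_+ a * d-1) (+-comm z a) ⟩
    a + z + a * d-1    ∎

%-cancel-+ : ∀ {a b x y d} .{{_ : NonZero d}} → a + x ≡ b + y → a % d ≡ b % d → x % d ≡ y % d
%-cancel-+ {a} {b} {x} {y} {d} eq a≡b = %-cancelˡ-+ b x y d (begin
  (b + x) % d      ≡⟨ [m+n]%d≡[m%d+n]%d b x d ⟩
  (b % d + x) % d  ≡⟨ cong (λ r → (r + x) % d) a≡b ⟨
  (a % d + x) % d  ≡⟨ [m+n]%d≡[m%d+n]%d a x d ⟨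
  (a + x) % d      ≡⟨ cong (_% d) eq ⟩
  (b + y) % d      ∎)

sum-map-step : {A : Set} (f g h : A → ℕ) (c : ℕ) → (∀ x → f x + c * g x ≡ h x + 1) →
               ∀ xs → sum (map f xs) + c * sum (map g xs) ≡ sum (map h xs) + length xs
sum-map-step f g h c step [] = *-zeroʳ c
sum-map-step f g h c step (x ∷ xs) = begin
  (f x + F) + c * (g x + G)       ≡⟨ cong ((f x + F) +_) (*-distribˡ-+ c (g x) G) ⟩
  (f x + F) + (c * g x + c * G)   ≡⟨ interchange (f x) F (c * g x) (c * G) ⟩
  (f x + c * g x) + (F + c * G)   ≡⟨ cong₂ _+_ (step x) (sum-map-step f g h c step xs) ⟩
  (h x + 1) + (H + length xs)     ≡⟨ interchange (h x) 1 H (length xs) ⟩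
  (h x + H) + suc (length xs)     ∎
  where
  F = sum (map f xs)
  G = sum (map g xs)
  H = sum (map h xs)

isShiftInvariant-* : ∀ {f a} → IsShiftInvariant f a → ∀ n → IsShiftInvariant f (n * a)
isShiftInvariant-* {f} inv zero m = cong f (sym (+-identityʳ m))
isShiftInvariant-* {f} {a} inv (suc n) m = begin
  f m                 ≡⟨ inv m ⟩
  f (m + a)           ≡⟨ isShiftInvariant-* inv n (m + a) ⟩
  f (m + a + n * a)   ≡⟨ cong f (+-assoc m a (n * a)) ⟩
  f (m + (a + n * a)) ∎

isShiftInvariant-combination : ∀ {f a b d} x y → IsShiftInvariant f a → IsShiftInvariant f b →
                               d + y * b ≡ x * a → IsShiftInvariant f d
isShiftInvariant-combination {f} {a} {b} {d} x y inv-a inv-b eq m = begin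
  f m                  ≡⟨ isShiftInvariant-* inv-a x m ⟩
  f (m + x * a)        ≡⟨ cong (λ z → f (m + z)) eq ⟨
  f (m + (d + y * b))  ≡⟨ cong f (+-assoc m d (y * b)) ⟨
  f (m + d + y * b)    ≡⟨ isShiftInvariant-* inv-b y (m + d) ⟨
  f (m + d)            ∎

isShiftInvariant-bézout : ∀ {f a b d} → Bézout.Identity d a b →
                          IsShiftInvariant f a → IsShiftInvariant f b → IsShiftInvariant f d
isShiftInvariant-bézout (Bézout.+- x y eq) inv-a inv-b = isShiftInvariant-combination x y inv-a inv-b eq
isShiftInvariant-bézout (Bézout.-+ x y eq) inv-a inv-b = isShiftInvariant-combination y x inv-b inv-a eq

isShiftInvariant⇒period-1 : ∀ {f} → IsShiftInvariant f 1 → HasPeriod f 1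
isShiftInvariant⇒period-1 inv = z<s , inv , λ { (suc _) _ (s<s ()) }

prime-period : ∀ {f p} → Prime p → IsShiftInvariant f p → ¬ IsShiftInvariant f 1 → HasPeriod f p
prime-period {p = p} pr inv-p ¬inv-1 = >-nonZero⁻¹ p {{prime⇒nonZero pr}} , inv-p , not-shorter
  where
  not-shorter : ∀ b → 0 < b → b < p → ¬ IsShiftInvariant _ b
  not-shorter (suc _) _ b<p inv-b =
    ¬inv-1 (isShiftInvariant-bézout (coprime-Bézout (prime⇒coprime pr b<p)) inv-p inv-b)

even-prime≡2 : ∀ {p} → Prime p → p % 2 ≡ 0 → p ≡ 2
even-prime≡2 {p} pr p%2≡0 with prime⇒irreducible pr (m%n≡0⇒n∣m p 2 p%2≡0)
... | inj₁ ()
... | inj₂ 2≡p = sym 2≡p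

clock-injective : ∀ {p} .{{_ : NonZero p}} m {t t′} → t < p → t′ < p →
                  clock p t m ≡ clock p t′ m → t ≡ t′
clock-injective {p} m {t} {t′} t<p t′<p eq = begin
  t       ≡⟨ m<n⇒m%n≡m t<p ⟨
  t % p   ≡⟨ %-cancelˡ-+ m t t′ p eq ⟩
  t′ % p  ≡⟨ m<n⇒m%n≡m t′<p ⟩
  t′      ∎

clockSum-periodic : ∀ p .{{_ : NonZero p}} ts → IsShiftInvariant (clockSum p ts) p
clockSum-periodic p ts m = cong (λ rs → sum rs % 2) (map-cong clock-+p ts)
  where
  clock-+p : ∀ t → clock p t m ≡ clock p t (m + p)
  clock-+p t = begin
    (m + t) % p      ≡⟨ [m+n]%n≡m%n (m + t) p ⟨
    (m + t + p) % p  ≡⟨ cong (_% p) (xy∙z≈xz∙y m p t) ⟨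
    (m + p + t) % p  ∎

module ClockSums (k : ℕ) where

  p : ℕ
  p = suc k

  carry : ℕ → ℕ
  carry r with r ≟ k
  ... | yes _ = 1
  ... | no _  = 0

  carry-top : carry k ≡ 1
  carry-top with k ≟ k
  ... | yes _ = refl
  ... | no k≢k = ⊥-elim (k≢k refl)

  carry-≢ : ∀ {r} → r ≢ k → carry r ≡ 0
  carry-≢ {r} r≢k with r ≟ k
  ... | yes r≡k = ⊥-elim (r≢k r≡k)
  ... | no _ = refl

  carry-+1 : ∀ {r} → r < p → (r + 1) % p + p * carry r ≡ r + 1
  carry-+1 {r} r<p with r ≟ k
  ... | yes refl = begin
    (k + 1) % p + p * 1  ≡⟨ cong₂ _+_ (cong (_% p) (+-comm k 1)) (*-identityʳ p) ⟩
    p % p + p            ≡⟨ cong (_+ p) (n%n≡0 p) ⟩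
    p                    ≡⟨ +-comm 1 k ⟩
    k + 1                ∎
  ... | no r≢k = begin
    (r + 1) % p + p * 0  ≡⟨ cong₂ _+_ (m<n⇒m%n≡m r+1<p) (*-zeroʳ p) ⟩
    r + 1 + 0            ≡⟨ +-identityʳ (r + 1) ⟩
    r + 1                ∎
    where
    r+1<p : r + 1 < p
    r+1<p = subst (_< p) (+-comm 1 r) (s<s (≤∧≢⇒< (≤-pred r<p) r≢k))

  clock-step : ∀ m t → clock p t (m + 1) + p * carry (clock p t m) ≡ clock p t m + 1
  clock-step m t = begin
    (m + 1 + t) % p + p * carry r          ≡⟨ cong (λ x → x % p + p * carry r) (xy∙z≈xz∙y m 1 t) ⟩
    (m + t + 1) % p + p * carry r          ≡⟨ cong (_+ p * carry r) ([m+n]%d≡[m%d+n]%d (m + t) 1 p) ⟩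
    (r + 1) % p + p * carry r              ≡⟨ carry-+1 (m%n<n (m + t) p) ⟩
    r + 1                                  ∎
    where
    r = clock p t m

  clockTotal : List ℕ → ℕ → ℕ
  clockTotal ts m = sum (map (λ t → clock p t m) ts)

  carries : List ℕ → ℕ → ℕ
  carries ts m = sum (map (λ t → carry (clock p t m)) ts)

  clockTotal-step : ∀ ts m → clockTotal ts (m + 1) + p * carries ts m ≡ clockTotal ts m + length ts
  clockTotal-step ts m = sum-map-step _ _ _ p (clock-step m) ts

  clock-top : ∀ m t → m + t ≡ k → clock p t m ≡ k
  clock-top m t eq = trans (cong (_% p) eq) (m<n⇒m%n≡m ≤-refl)

  carries≡0 : ∀ m {ts t} → All (_< p) ts → t < p → t ∉ ts → clock p t m ≡ k → carries ts m ≡ 0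
  carries≡0 m {[]} _ _ _ _ = refl
  carries≡0 m {t′ ∷ ts} (t′<p ∷ ts<p) t<p t∉ hit = cong₂ _+_
    (carry-≢ λ hit′ → t∉ (here (clock-injective m t<p t′<p (trans hit (sym hit′)))))
    (carries≡0 m ts<p t<p (t∉ ∘ there) hit)

  carries≡1 : ∀ m {ts t} → Unique ts → All (_< p) ts → t ∈ ts → clock p t m ≡ k → carries ts m ≡ 1
  carries≡1 m {t′ ∷ ts} (t′∉ts ∷ _) (t′<p ∷ ts<p) (here refl) hit =
    cong₂ _+_ (trans (cong carry hit) carry-top) (carries≡0 m ts<p t′<p (All¬⇒¬Any t′∉ts) hit)
  carries≡1 m {t′ ∷ ts} (t′∉ts ∷ u) (t′<p ∷ ts<p) (there t∈ts) hit = cong₂ _+_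
    (carry-≢ λ hit′ → All.lookup t′∉ts t∈ts
      (clock-injective m t′<p (All.lookup ts<p t∈ts) (trans hit′ (sym hit))))
    (carries≡1 m u ts<p t∈ts hit)

  clockSum-shift-1 : ∀ {ts} → Unique ts → All (_< p) ts → length ts ≡ p →
                     IsShiftInvariant (clockSum p ts) 1
  clockSum-shift-1 {ts} u ts<p len≡p m = cong (_% 2) (sym (+-cancelʳ-≡ p _ _ (begin
    clockTotal ts (m + 1) + p                    ≡⟨ cong (clockTotal ts (m + 1) +_) p*carries≡p ⟨
    clockTotal ts (m + 1) + p * carries ts m     ≡⟨ clockTotal-step ts m ⟩
    clockTotal ts m + length ts                  ≡⟨ cong (clockTotal ts m +_) len≡p ⟩
    clockTotal ts m + p                          ∎)))
    where
    r≤k : m % p ≤ k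
    r≤k = ≤-pred (m%n<n m p)
    hit : clock p (k ∸ m % p) m ≡ k
    hit = trans ([m+n]%d≡[m%d+n]%d m (k ∸ m % p) p) (clock-top (m % p) (k ∸ m % p) (m+[n∸m]≡n r≤k))
    hit∈ts : k ∸ m % p ∈ ts
    hit∈ts = length≡⇒∈ u ts<p len≡p (s<s (m∸n≤m k (m % p)))
    p*carries≡p : p * carries ts m ≡ p
    p*carries≡p = begin
      p * carries ts m ≡⟨ cong (p *_) (carries≡1 m u ts<p hit∈ts hit) ⟩
      p * 1            ≡⟨ *-identityʳ p ⟩
      p                ∎

  carries-parity : ∀ ts → IsShiftInvariant (clockSum p ts) 1 → ∀ m → p * carries ts m % 2 ≡ length ts % 2
  carries-parity ts inv m =
    %-cancel-+ {clockTotal ts (m + 1)} {clockTotal ts m} {d = 2} (clockTotal-step ts m) (sym (inv m))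

  clockSum-not-shift-1 : ∀ {ts} → Prime p → Unique ts → All (_< p) ts → 1 ≤ length ts → length ts < p →
                         ¬ IsShiftInvariant (clockSum p ts) 1
  clockSum-not-shift-1 {ts@(t ∷ _)} pr u ts<p@(t<p ∷ _) len≥1 len<p inv with length<⇒∃∉ len<p
  ... | v , v<p , v∉ts = 0≢1+n (trans (sym len%2≡0) (cong (_% 2) len≡1))
    where
    p%2≡len%2 : p % 2 ≡ length ts % 2
    p%2≡len%2 = begin
      p % 2                      ≡⟨ cong (_% 2) (*-identityʳ p) ⟨
      p * 1 % 2                  ≡⟨ cong (λ c → p * c % 2) (carries≡1 (k ∸ t) u ts<p (here refl)
                                      (clock-top (k ∸ t) t (m∸n+n≡m (≤-pred t<p)))) ⟨
      p * carries ts (k ∸ t) % 2 ≡⟨ carries-parity ts inv (k ∸ t) ⟩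
      length ts % 2              ∎
    len%2≡0 : length ts % 2 ≡ 0
    len%2≡0 = begin
      length ts % 2              ≡⟨ carries-parity ts inv (k ∸ v) ⟨
      p * carries ts (k ∸ v) % 2 ≡⟨ cong (λ c → p * c % 2) (carries≡0 (k ∸ v) ts<p v<p v∉ts
                                      (clock-top (k ∸ v) v (m∸n+n≡m (≤-pred v<p)))) ⟩
      p * 0 % 2                  ≡⟨ cong (_% 2) (*-zeroʳ p) ⟩
      0                          ∎
    len≡1 : length ts ≡ 1
    len≡1 = ≤-antisym (≤-pred (subst (length ts <_) (even-prime≡2 pr (trans p%2≡len%2 len%2≡0)) len<p)) len≥1


mainTheorem3 : (p : ℕ) → Prime p → .{{_ : NonZero p}} → (ts : List ℕ) → All (_< p) ts → Unique ts
    → (length ts ≡ p → HasPeriod (clockSum p ts) 1)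
    × (1 ≤ length ts → length ts < p → HasPeriod (clockSum p ts) p)
mainTheorem3 (suc k) pr ts ts<p u =
    (λ len≡p → isShiftInvariant⇒period-1 (clockSum-shift-1 u ts<p len≡p))
  , (λ len≥1 len<p → prime-period pr (clockSum-periodic (suc k) ts)
                       (clockSum-not-shift-1 pr u ts<p len≥1 len<p))
  where open ClockSums k
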